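{- Let $(G,Z)$ be a plantation. Then there is a dyadic plantation $(G',Z')$ with $|G'|\le|G|$ and $|Z'|\le|Z|$ such that $n(G,Z)\le n(G',Z')$.
   Context: Fix an integer $s\ge1$. Graphs are finite and simple; $|G|$ is the number of vertices. Two vertex sets are anticomplete if they are disjoint with no edges between them. A graph is $s\mathcal{O}$-free if no $s$ cycles of it are pairwise vertex-disjoint and pairwise anticomplete. $Z\subseteq V(G)$ is cycle-hitting if every cycle of $G$ meets $Z$. A plantation is a pair $(G,Z)$ with $G$ an $s\mathcal{O}$-free graph and $Z\subseteq V(G)$ cycle-hitting. $(G,Z)$ is dyadic if $Z$ is stable and every vertex of $V(G)\setminus Z$ has at most two neighbours in $Z$. A $Z$-covering path is an induced path $P$ of $G$ with $Z\subseteq V(P)$ and both ends of $P$ in $Z$; $n(G,Z)$ is the number of $Z$-covering paths. -}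

module Defs where

open import Data.Nat using (ℕ; zero; suc; _+_; _≤_; _≡ᵇ_)
open import Data.Bool using (Bool; true; false; _∧_; _∨_; not; if_then_else_)
open import Data.Fin using (Fin; zero; suc; toℕ; fromℕ; inject₁; _≟_)
open import Data.List using (List; []; _∷_; allFin; upTo; map)
open import Data.Nat.ListAction using (sum)
open import Data.Bool.ListAction using (any; all)
open import Data.Product using (Σ; _×_; _,_)
open import Relation.Binary.PropositionalEquality using (_≡_; _≢_)
open import Relation.Nullary using (¬_)
open import Relation.Nullary.Decidable using (⌊_⌋)

-- Finite simple graphs on vertex set Fin n (|G| = n)

record Graph : Set where
  field
    order  : ℕ
    adj    : Fin order → Fin order → Bool
    sym    : ∀ u v → adj u v ≡ adj v u
    irrefl : ∀ v → adj v v ≡ false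
open Graph public

Vertex : Graph → Set
Vertex G = Fin (order G)

VSet : Graph → Set
VSet G = Vertex G → Bool

countFin : ∀ k → (Fin k → Bool) → ℕ
countFin k p = sum (map (λ i → if p i then 1 else 0) (allFin k))

size : (G : Graph) → VSet G → ℕ
size G Z = countFin (order G) Z

record Cycle (G : Graph) : Set where
  field
    m       : ℕ                                  -- length is m + 3
    vtx     : Fin (suc (suc (suc m))) → Vertex G
    inj     : ∀ i j → vtx i ≡ vtx j → i ≡ j
    step    : ∀ (i : Fin (suc (suc m))) → adj G (vtx (inject₁ i)) (vtx (suc i)) ≡ true
    closing : adj G (vtx (fromℕ (suc (suc m)))) (vtx zero) ≡ true
open Cycle public

Anticomplete : (G : Graph) → Cycle G → Cycle G → Set
Anticomplete G C D =
  ∀ i j → (vtx C i ≢ vtx D j) × (adj G (vtx C i) (vtx D j) ≡ false)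

SOFree : ℕ → Graph → Set
SOFree s G = ¬ (Σ (Fin s → Cycle G) λ Cs →
                  ∀ a b → a ≢ b → Anticomplete G (Cs a) (Cs b))

CycleHitting : (G : Graph) → VSet G → Set
CycleHitting G Z = ∀ (C : Cycle G) → Σ (Fin (suc (suc (suc (m C))))) λ i → Z (vtx C i) ≡ true

Plantation : ℕ → (G : Graph) → VSet G → Set
Plantation s G Z = SOFree s G × CycleHitting G Z

Stable : (G : Graph) → VSet G → Set
Stable G Z = ∀ u v → Z u ≡ true → Z v ≡ true → adj G u v ≡ false

Dyadic : (G : Graph) → VSet G → Set
Dyadic G Z = Stable G Z ×
  (∀ v → Z v ≡ false → countFin (order G) (λ u → Z u ∧ adj G v u) ≤ 2)

anyFun : ∀ {A : Set} k → List A → ((Fin k → A) → Bool) → Bool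
anyFun zero    as p = p (λ ())
anyFun (suc k) as p =
  any (λ x → anyFun k as (λ f → p (λ { zero → x ; (suc i) → f i }))) as

countFun : ∀ {A : Set} k → List A → ((Fin k → A) → Bool) → ℕ
countFun zero    as p = if p (λ ()) then 1 else 0
countFun (suc k) as p =
  sum (map (λ x → countFun k as (λ f → p (λ { zero → x ; (suc i) → f i }))) as)

_==ᶠ_ : ∀ {k} → Fin k → Fin k → Bool
i ==ᶠ j = ⌊ i ≟ j ⌋

consecutive : ∀ {k} → Fin k → Fin k → Bool
consecutive i j = ((suc (toℕ i)) ≡ᵇ toℕ j) ∨ ((suc (toℕ j)) ≡ᵇ toℕ i)

isInducedPath : (G : Graph) → ∀ k → (Fin k → Vertex G) → Bool
isInducedPath G k v =
  all (λ i → all (λ j →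
        (not (v i ==ᶠ v j) ∨ (i ==ᶠ j)) ∧
        (adj G (v i) (v j) ==ᵇᵇ consecutive i j)) (allFin k)) (allFin k)
  where
  _==ᵇᵇ_ : Bool → Bool → Bool
  true  ==ᵇᵇ b = b
  false ==ᵇᵇ b = not b

isZCoveringPathSet : (G : Graph) → VSet G → VSet G → Bool
isZCoveringPathSet G Z S =
  all (λ u → not (Z u) ∨ S u) (allFin (order G)) ∧
  any (λ m → anyFun (suc m) (allFin (order G)) (λ v →
        isInducedPath G (suc m) v ∧
        Z (v zero) ∧ Z (v (fromℕ m)) ∧
        all (λ i → S (v i)) (allFin (suc m)) ∧
        all (λ u → not (S u) ∨ any (λ i → v i ==ᶠ u) (allFin (suc m))) (allFin (order G))))
      (upTo (order G))

-- n(G,Z): the number of Z-covering paths.  An induced path is determined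
-- by its vertex set, so we count vertex sets of Z-covering paths.
nPaths : (G : Graph) → VSet G → ℕ
nPaths G Z = countFun (order G) (true ∷ false ∷ []) (isZCoveringPathSet G Z)

-- The reduction keeps the vertex set and repeats two steps.  If two vertices z₁, z₂ of Z are
-- adjacent, contract the edge: z₂ leaves Z and becomes isolated, z₁ inherits its neighbours.
-- Every cycle of the contraction lifts to a cycle of G whose vertices map into it under z₂ ↦ z₁,
-- so Z ∖ z₂ still hits all cycles and packings of anticomplete cycles lift; a Z-covering path
-- passes through z₁ and z₂ consecutively, and deleting z₂ from it gives a covering path of the
-- contraction, distinct covering paths giving distinct ones.  If instead some vertex x has three
-- neighbours in Z, delete all edges at x: a vertex of an induced path has at most two neighbours
-- on it, so no Z-covering path uses x.  Each step isolates a vertex that had a neighbour, and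
-- when neither applies Z is stable and every vertex has at most two neighbours in Z.
module Submission where

open import Defs hiding (sym)
open import Data.Nat using (ℕ; zero; suc; _+_; _≤_; _<_; z≤n; s≤s)
import Data.Nat.Properties as ℕ
open import Data.Nat.Properties
  using (≤-refl; ≤-trans; ≤-antisym; ≤-pred; ≤-reflexive; <-trans; <-≤-trans; <-irrefl; <⇒≱;
         n≤1+n; n<1+n; m≤n+m; +-suc; +-mono-≤; +-monoˡ-≤; +-mono-≤-<)
open import Data.Bool using (Bool; true; false; _∧_; _∨_; not; if_then_else_; T)
open import Data.Bool.Properties using (¬-not; ⇔→≡; ∧-zeroʳ; ∧-identityʳ; ∧-comm)
open import Data.Fin using (Fin; zero; suc; toℕ; fromℕ; _≟_; punchIn; punchOut; inject₁)
import Data.Fin.Properties as Fin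
open import Data.List using (List; []; _∷_; allFin; upTo; map)
open import Data.List.Properties using (map-tabulate)
open import Data.List.Membership.Propositional using (_∈_)
open import Data.List.Membership.Propositional.Properties using (∈-allFin; ∈-upTo⁺; ∈-upTo⁻)
open import Data.List.Relation.Unary.Any using (here; there)
open import Data.Nat.ListAction using (sum)
open import Data.Bool.ListAction using (any; all)
open import Data.Product using (Σ; ∃; _×_; _,_; proj₁; proj₂)
open import Data.Sum using (_⊎_; inj₁; inj₂; swap) renaming (map to ⊎-map)
open import Data.Empty using (⊥-elim)
open import Function.Base using (id; _∘_; _on_)
open import Function.Bundles using (mk⇔)
open import Relation.Binary.PropositionalEquality
  using (_≡_; _≢_; refl; sym; trans; cong; cong₂; subst; subst₂; _≗_; module ≡-Reasoning)
open import Relation.Nullary using (¬_; Dec; yes; no)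
open import Relation.Nullary.Decidable using (_⊎-dec_; _×-dec_)
open import Induction.WellFounded using (Acc; acc)
open import Data.Nat.Induction using (<-wellFounded)
import Relation.Binary.Construct.On as On
import Data.Bool.Properties as Bool

∧-trueˡ : ∀ {a b} → a ∧ b ≡ true → a ≡ true
∧-trueˡ {true} _ = refl

∧-trueʳ : ∀ {a b} → a ∧ b ≡ true → b ≡ true
∧-trueʳ {true} p = p

∧-true⁺ : ∀ {a b} → a ≡ true → b ≡ true → a ∧ b ≡ true
∧-true⁺ refl refl = refl

∧-true⁻ : ∀ a {b} → a ∧ b ≡ true → a ≡ true × b ≡ true
∧-true⁻ true h = refl , h

∨-true⁻ : ∀ {a b} → a ∨ b ≡ true → a ≡ true ⊎ b ≡ true
∨-true⁻ {true}  _ = inj₁ refl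
∨-true⁻ {false} p = inj₂ p

∨-trueˡ : ∀ {a} b → a ≡ true → a ∨ b ≡ true
∨-trueˡ b refl = refl

∨-trueʳ : ∀ a {b} → b ≡ true → a ∨ b ≡ true
∨-trueʳ true  _ = refl
∨-trueʳ false p = p

true≢false : true ≢ false
true≢false ()

not-true⁻ : ∀ {a} → not a ≡ true → a ≡ false
not-true⁻ {false} _ = refl

not-true⁺ : ∀ {a} → a ≡ false → not a ≡ true
not-true⁺ refl = refl

true⇔⇒≡ : ∀ {a b} → (a ≡ true → b ≡ true) → (b ≡ true → a ≡ true) → a ≡ b
true⇔⇒≡ to from = ⇔→≡ (mk⇔ to from)

T⇒≡true : ∀ {b} → T b → b ≡ true
T⇒≡true {true} _ = refl

≡true⇒T : ∀ {b} → b ≡ true → T b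
≡true⇒T refl = _

any-true⁻ : ∀ {A : Set} (p : A → Bool) xs → any p xs ≡ true → ∃ λ x → x ∈ xs × p x ≡ true
any-true⁻ p (x ∷ xs) h with p x in eq
... | true  = x , here refl , eq
... | false with y , y∈xs , py ← any-true⁻ p xs h = y , there y∈xs , py

any-true⁺ : ∀ {A : Set} (p : A → Bool) {xs x} → x ∈ xs → p x ≡ true → any p xs ≡ true
any-true⁺ p           (here refl) px rewrite px = refl
any-true⁺ p {y ∷ _} (there x∈xs) px = ∨-trueʳ (p y) (any-true⁺ p x∈xs px)

all-true⁻ : ∀ {A : Set} (p : A → Bool) {xs x} → all p xs ≡ true → x ∈ xs → p x ≡ true
all-true⁻ p           h (here refl)  = ∧-trueˡ h
all-true⁻ p {y ∷ _} h (there x∈xs) = all-true⁻ p (∧-trueʳ {p y} h) x∈xs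

all-true⁺ : ∀ {A : Set} (p : A → Bool) xs → (∀ x → x ∈ xs → p x ≡ true) → all p xs ≡ true
all-true⁺ p []       h = refl
all-true⁺ p (x ∷ xs) h = ∧-true⁺ (h x (here refl)) (all-true⁺ p xs (λ y y∈xs → h y (there y∈xs)))

all-false⁻ : ∀ {A : Set} (p : A → Bool) xs → all p xs ≡ false → ∃ λ x → x ∈ xs × p x ≡ false
all-false⁻ p (x ∷ xs) h with p x in eq
... | false = x , here refl , eq
... | true with y , y∈xs , py ← all-false⁻ p xs h = y , there y∈xs , py

sum-map-mono : ∀ {A : Set} {f g : A → ℕ} xs → (∀ x → f x ≤ g x) → sum (map f xs) ≤ sum (map g xs)
sum-map-mono []       f≤g = z≤n
sum-map-mono (x ∷ xs) f≤g = +-mono-≤ (f≤g x) (sum-map-mono xs f≤g)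

sum-map-zero : ∀ {A : Set} {f : A → ℕ} xs → (∀ x → f x ≡ 0) → sum (map f xs) ≡ 0
sum-map-zero []       f≡0 = refl
sum-map-zero (x ∷ xs) f≡0 rewrite f≡0 x = sum-map-zero xs f≡0

module _ {k : ℕ} {i j : Fin k} where

  ==ᶠ⇒≡ : (i ==ᶠ j) ≡ true → i ≡ j
  ==ᶠ⇒≡ h with i ≟ j
  ... | yes i≡j = i≡j

  ≡⇒==ᶠ : i ≡ j → (i ==ᶠ j) ≡ true
  ≡⇒==ᶠ i≡j with i ≟ j
  ... | yes _   = refl
  ... | no  i≢j = ⊥-elim (i≢j i≡j)

  ≢⇒==ᶠ-false : i ≢ j → (i ==ᶠ j) ≡ false
  ≢⇒==ᶠ-false i≢j = ¬-not (λ h → i≢j (==ᶠ⇒≡ h))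

  ==ᶠ-false⇒≢ : (i ==ᶠ j) ≡ false → i ≢ j
  ==ᶠ-false⇒≢ h i≡j with () ← trans (sym h) (≡⇒==ᶠ i≡j)

==ᶠ-resp : ∀ {k l} {i j : Fin k} {i′ j′ : Fin l} →
  (i ≡ j → i′ ≡ j′) → (i′ ≡ j′ → i ≡ j) → (i ==ᶠ j) ≡ (i′ ==ᶠ j′)
==ᶠ-resp to from = true⇔⇒≡ (λ h → ≡⇒==ᶠ (to (==ᶠ⇒≡ h))) (λ h → ≡⇒==ᶠ (from (==ᶠ⇒≡ h)))

==ᶠ-suc : ∀ {k} (i j : Fin k) → (suc i ==ᶠ suc j) ≡ (i ==ᶠ j)
==ᶠ-suc i j = ==ᶠ-resp Fin.suc-injective (cong suc)

≗-cons : ∀ {A : Set} {k} {g h : Fin (suc k) → A} →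
  g zero ≡ h zero → (∀ i → g (suc i) ≡ h (suc i)) → g ≗ h
≗-cons g0≡h0 _     zero    = g0≡h0
≗-cons _     gs≡hs (suc i) = gs≡hs i

inject₁⊎fromℕ : ∀ {n} (i : Fin (suc n)) → (∃ λ i′ → i ≡ inject₁ i′) ⊎ i ≡ fromℕ n
inject₁⊎fromℕ {zero}  zero    = inj₂ refl
inject₁⊎fromℕ {suc n} zero    = inj₁ (zero , refl)
inject₁⊎fromℕ {suc n} (suc i) with inject₁⊎fromℕ i
... | inj₁ (i′ , refl) = inj₁ (suc i′ , refl)
... | inj₂ refl        = inj₂ refl

snoc : ∀ {A : Set} {n} → (Fin n → A) → A → Fin (suc n) → A
snoc {n = zero}  f x zero    = x
snoc {n = suc n} f x zero    = f zero
snoc {n = suc n} f x (suc i) = snoc (f ∘ suc) x i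

snoc-inject₁ : ∀ {A : Set} {n} (f : Fin n → A) x i → snoc f x (inject₁ i) ≡ f i
snoc-inject₁ {n = suc n} f x zero    = refl
snoc-inject₁ {n = suc n} f x (suc i) = snoc-inject₁ (f ∘ suc) x i

snoc-last : ∀ {A : Set} {n} (f : Fin n → A) x → snoc f x (fromℕ n) ≡ x
snoc-last {n = zero}  f x = refl
snoc-last {n = suc n} f x = snoc-last (f ∘ suc) x

snoc-all : ∀ {A : Set} {P : A → Set} {n} {f : Fin n → A} {x} → (∀ i → P (f i)) → P x →
  ∀ i → P (snoc f x i)
snoc-all {P = P} {f = f} {x} Pf Px i with inject₁⊎fromℕ i
... | inj₁ (j , refl) = subst P (sym (snoc-inject₁ f x j)) (Pf j)
... | inj₂ refl       = subst P (sym (snoc-last f x)) Px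

snoc-injective : ∀ {A : Set} {n} (f : Fin n → A) x → (∀ i j → f i ≡ f j → i ≡ j) → (∀ i → f i ≢ x) →
  ∀ i j → snoc f x i ≡ snoc f x j → i ≡ j
snoc-injective f x f-inj f≢x i j e with inject₁⊎fromℕ i | inject₁⊎fromℕ j
... | inj₁ (i′ , refl) | inj₁ (j′ , refl) =
  cong inject₁ (f-inj i′ j′ (trans (sym (snoc-inject₁ f x i′)) (trans e (snoc-inject₁ f x j′))))
... | inj₁ (i′ , refl) | inj₂ refl =
  ⊥-elim (f≢x i′ (trans (sym (snoc-inject₁ f x i′)) (trans e (snoc-last f x))))
... | inj₂ refl | inj₁ (j′ , refl) =
  ⊥-elim (f≢x j′ (trans (sym (snoc-inject₁ f x j′)) (trans (sym e) (snoc-last f x))))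
... | inj₂ refl | inj₂ refl = refl

_∖_ : ∀ {k} → (Fin k → Bool) → Fin k → Fin k → Bool
(S ∖ c) u = S u ∧ not (u ==ᶠ c)

∖-self : ∀ {k} (S : Fin k → Bool) c → (S ∖ c) c ≡ false
∖-self S c rewrite ≡⇒==ᶠ {i = c} refl = ∧-zeroʳ (S c)

∖-other : ∀ {k} (S : Fin k → Bool) {c u} → u ≢ c → (S ∖ c) u ≡ S u
∖-other S {u = u} u≢c rewrite ≢⇒==ᶠ-false u≢c = ∧-identityʳ (S u)

∖-true⁻ : ∀ {k} {S : Fin k → Bool} {c u} → (S ∖ c) u ≡ true → S u ≡ true × u ≢ c
∖-true⁻ {S = S} {u = u} h = ∧-trueˡ h , ==ᶠ-false⇒≢ (not-true⁻ (∧-trueʳ {S u} h))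

∖-true⁺ : ∀ {k} {S : Fin k → Bool} {c u} → S u ≡ true → u ≢ c → (S ∖ c) u ≡ true
∖-true⁺ Su u≢c = ∧-true⁺ Su (not-true⁺ (≢⇒==ᶠ-false u≢c))

∖-suc : ∀ {k} (S : Fin (suc k) → Bool) c i → (S ∖ suc c) (suc i) ≡ ((S ∘ suc) ∖ c) i
∖-suc S c i = cong (λ b → S (suc i) ∧ not b) (==ᶠ-suc i c)

indicator : Bool → ℕ
indicator b = if b then 1 else 0

indicator-mono : ∀ {a b} → (a ≡ true → b ≡ true) → indicator a ≤ indicator b
indicator-mono {false} _ = z≤n
indicator-mono {true}  h rewrite h refl = ≤-refl

indicator-false : ∀ {b} → b ≢ true → indicator b ≡ 0
indicator-false {true}  b≢true = ⊥-elim (b≢true refl)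
indicator-false {false} _      = refl

countFin-suc : ∀ k (p : Fin (suc k) → Bool) →
  countFin (suc k) p ≡ indicator (p zero) + countFin k (p ∘ suc)
countFin-suc k p = trans (cong sum (map-tabulate id h))
                         (cong (indicator (p zero) +_) (sym (cong sum (map-tabulate id (h ∘ suc)))))
  where
  h : Fin (suc k) → ℕ
  h i = indicator (p i)

countFin-cong : ∀ k {p q : Fin k → Bool} → p ≗ q → countFin k p ≡ countFin k q
countFin-cong zero    p≗q = refl
countFin-cong (suc k) {p} {q} p≗q = begin
  countFin (suc k) p                         ≡⟨ countFin-suc k p ⟩
  indicator (p zero) + countFin k (p ∘ suc)  ≡⟨ cong₂ _+_ (cong indicator (p≗q zero))
                                                         (countFin-cong k (p≗q ∘ suc)) ⟩
  indicator (q zero) + countFin k (q ∘ suc)  ≡⟨ countFin-suc k q ⟨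
  countFin (suc k) q                         ∎
  where open ≡-Reasoning

countFin-mono : ∀ k {p q : Fin k → Bool} → (∀ i → p i ≡ true → q i ≡ true) →
  countFin k p ≤ countFin k q
countFin-mono zero    p⊆q = z≤n
countFin-mono (suc k) {p} {q} p⊆q rewrite countFin-suc k p | countFin-suc k q =
  +-mono-≤ (indicator-mono (p⊆q zero)) (countFin-mono k (p⊆q ∘ suc))

countFin-mono-< : ∀ k {p q : Fin k → Bool} → (∀ i → p i ≡ true → q i ≡ true) →
  ∀ a → p a ≡ false → q a ≡ true → countFin k p < countFin k q
countFin-mono-< (suc k) {p} {q} p⊆q zero pa qa
  rewrite countFin-suc k p | countFin-suc k q | pa | qa = s≤s (countFin-mono k (p⊆q ∘ suc))
countFin-mono-< (suc k) {p} {q} p⊆q (suc a) pa qa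
  rewrite countFin-suc k p | countFin-suc k q =
  +-mono-≤-< (indicator-mono (p⊆q zero)) (countFin-mono-< k (p⊆q ∘ suc) a pa qa)

countFin-∖ : ∀ k (p : Fin k → Bool) {a} → p a ≡ true → countFin k p ≡ suc (countFin k (p ∖ a))
countFin-∖ (suc k) p {zero} pa = begin
  countFin (suc k) p
    ≡⟨ countFin-suc k p ⟩
  indicator (p zero) + countFin k (p ∘ suc)
    ≡⟨ cong₂ _+_ (cong indicator pa) (countFin-cong k λ i → sym (∖-other p {zero} {suc i} (λ ()))) ⟩
  suc (indicator false + countFin k ((p ∖ zero) ∘ suc))
    ≡⟨ cong (λ b → suc (indicator b + countFin k ((p ∖ zero) ∘ suc))) (∖-self p zero) ⟨
  suc (indicator ((p ∖ zero) zero) + countFin k ((p ∖ zero) ∘ suc))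
    ≡⟨ cong suc (countFin-suc k (p ∖ zero)) ⟨
  suc (countFin (suc k) (p ∖ zero))
    ∎
  where open ≡-Reasoning
countFin-∖ (suc k) p {suc a} pa = begin
  countFin (suc k) p
    ≡⟨ countFin-suc k p ⟩
  indicator (p zero) + countFin k (p ∘ suc)
    ≡⟨ cong (indicator (p zero) +_) (countFin-∖ k (p ∘ suc) pa) ⟩
  indicator (p zero) + suc (countFin k ((p ∘ suc) ∖ a))
    ≡⟨ +-suc _ _ ⟩
  suc (indicator (p zero) + countFin k ((p ∘ suc) ∖ a))
    ≡⟨ cong suc (cong₂ _+_ (cong indicator (∖-other p {suc a} {zero} (λ ())))
                           (countFin-cong k (∖-suc p a))) ⟨
  suc (indicator ((p ∖ suc a) zero) + countFin k ((p ∖ suc a) ∘ suc))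
    ≡⟨ cong suc (countFin-suc k (p ∖ suc a)) ⟨
  suc (countFin (suc k) (p ∖ suc a))
    ∎
  where open ≡-Reasoning

countFin-witness : ∀ k (p : Fin k → Bool) → 1 ≤ countFin k p → ∃ λ a → p a ≡ true
countFin-witness (suc k) p h rewrite countFin-suc k p with p zero in pzero
... | true  = zero , pzero
... | false with a , pa ← countFin-witness k (p ∘ suc) h = suc a , pa

countFin-pick : ∀ k (p : Fin k → Bool) {n} → suc n ≤ countFin k p →
  ∃ λ a → p a ≡ true × n ≤ countFin k (p ∖ a)
countFin-pick k p h with a , pa ← countFin-witness k p (≤-trans (s≤s z≤n) h) =
  a , pa , ≤-pred (subst (_ ≤_) (countFin-∖ k p pa) h)

countFin-three : ∀ k (p : Fin k → Bool) → 3 ≤ countFin k p →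
  Σ (Fin k) λ a → Σ (Fin k) λ b → Σ (Fin k) λ c →
    p a ≡ true × p b ≡ true × p c ≡ true × a ≢ b × a ≢ c × b ≢ c
countFin-three k p h
  with a , pa , h₁ ← countFin-pick k p h
  with b , pb∖a , h₂ ← countFin-pick k (p ∖ a) h₁
  with c , pc∖a∖b , _ ← countFin-pick k ((p ∖ a) ∖ b) h₂
  with pb , b≢a ← ∖-true⁻ {S = p} pb∖a
  with pc∖a , c≢b ← ∖-true⁻ {S = p ∖ a} pc∖a∖b
  with pc , c≢a ← ∖-true⁻ {S = p} pc∖a =
  a , b , c , pa , pb , pc , (λ e → b≢a (sym e)) , (λ e → c≢a (sym e)) , (λ e → c≢b (sym e))

countFun-mono : ∀ {A : Set} k (as : List A) {p q : (Fin k → A) → Bool} →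
  (∀ f → p f ≡ true → q f ≡ true) → countFun k as p ≤ countFun k as q
countFun-mono zero    as p⊆q = indicator-mono (p⊆q _)
countFun-mono (suc k) as p⊆q = sum-map-mono as (λ x → countFun-mono k as (λ f → p⊆q _))

countFun-empty : ∀ {A : Set} k (as : List A) {p : (Fin k → A) → Bool} →
  (∀ f → p f ≢ true) → countFun k as p ≡ 0
countFun-empty zero    as p≢true = indicator-false (p≢true _)
countFun-empty (suc k) as p≢true = sum-map-zero as (λ x → countFun-empty k as (λ f → p≢true _))

-- Deleting c is injective on the sets containing c.  The list of values is kept abstract
-- (as ≡ true ∷ false ∷ []) so that countFun does not unfold during unification of the recursive calls.
countFun-≤-∖-over : ∀ k (c : Fin k) (p q : (Fin k → Bool) → Bool) as → as ≡ true ∷ false ∷ [] →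
  (∀ S → p S ≡ true → S c ≡ true) →
  (∀ S → p S ≡ true → q (S ∖ c) ≡ true) →
  (∀ S S′ → S ≗ S′ → q S ≡ q S′) →
  countFun k as p ≤ countFun k as q
countFun-≤-∖-over (suc k) zero p q as as≡bits p⇒c p⇒q q-cong =
  sum-over-bits (countFun-empty k as (λ f pf → true≢false (sym (p⇒c _ pf))))
                (countFun-mono k as (λ f → move-to-false _ _ refl (λ _ → refl)))
  where
  sum-over-bits : ∀ {F G : Bool → ℕ} → F false ≡ 0 → F true ≤ G false → sum (map F as) ≤ sum (map G as)
  sum-over-bits {F} {G} F0 le rewrite as≡bits | F0 =
    ≤-trans (+-monoˡ-≤ 0 le) (m≤n+m (G false + 0) (G true))
  move-to-false : ∀ (g h : Fin (suc k) → Bool) → h zero ≡ false → (∀ i → h (suc i) ≡ g (suc i)) →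
    p g ≡ true → q h ≡ true
  move-to-false g h h0 hs pg =
    trans (q-cong h (g ∖ zero) (≗-cons (trans h0 (sym (∖-self g zero)))
                                      (λ i → trans (hs i) (sym (∖-other g {zero} {suc i} (λ ()))))))
          (p⇒q g pg)
countFun-≤-∖-over (suc k) (suc c) p q as as≡bits p⇒c p⇒q q-cong =
  sum-map-mono as
    (λ x → countFun-≤-∖-over k c _ _ as as≡bits (λ S → p⇒c _) (λ S → shift _ _ refl (λ _ → refl))
                              (λ S S′ S≗S′ → q-cong _ _ (≗-cons refl S≗S′)))
  where
  shift : ∀ (g h : Fin (suc k) → Bool) → h zero ≡ g zero → (∀ i → h (suc i) ≡ ((g ∘ suc) ∖ c) i) →
    p g ≡ true → q h ≡ true
  shift g h h0 hs pg =
    trans (q-cong h (g ∖ suc c) (≗-cons (trans h0 (sym (∖-other g {suc c} {zero} (λ ()))))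
                                       (λ i → trans (hs i) (sym (∖-suc g c i)))))
          (p⇒q g pg)

countFun-≤-∖ : ∀ k (c : Fin k) (p q : (Fin k → Bool) → Bool) →
  (∀ S → p S ≡ true → S c ≡ true) →
  (∀ S → p S ≡ true → q (S ∖ c) ≡ true) →
  (∀ S S′ → S ≗ S′ → q S ≡ q S′) →
  countFun k (true ∷ false ∷ []) p ≤ countFun k (true ∷ false ∷ []) q
countFun-≤-∖ k c p q = countFun-≤-∖-over k c p q _ refl

anyFun-true⁻ : ∀ {A : Set} k (as : List A) p → anyFun k as p ≡ true → ∃ λ (f : Fin k → A) → p f ≡ true
anyFun-true⁻ zero    as p h = _ , h
anyFun-true⁻ (suc k) as p h
  with _ , _ , h′ ← any-true⁻ _ as h
  with _ , pf ← anyFun-true⁻ k as _ h′ = _ , pf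

anyFun-true⁺ : ∀ {A : Set} k (as : List A) p (f : Fin k → A) → (∀ i → f i ∈ as) →
  (∀ g → g ≗ f → p g ≡ true) → anyFun k as p ≡ true
anyFun-true⁺ zero    as p f f∈as pf = pf _ (λ ())
anyFun-true⁺ (suc k) as p f f∈as pf =
  any-true⁺ _ (f∈as zero)
    (anyFun-true⁺ k as _ (f ∘ suc) (f∈as ∘ suc) (λ g g≗f → pf _ (≗-cons refl g≗f)))

Consecutiveℕ : ℕ → ℕ → Set
Consecutiveℕ m n = suc m ≡ n ⊎ suc n ≡ m

Consecutiveℕ? : ∀ m n → Dec (Consecutiveℕ m n)
Consecutiveℕ? m n = (suc m ℕ.≟ n) ⊎-dec (suc n ℕ.≟ m)

Consecutiveℕ-irrefl : ∀ {n} → ¬ Consecutiveℕ n n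
Consecutiveℕ-irrefl (inj₁ ())
Consecutiveℕ-irrefl (inj₂ ())

Consecutiveℕ-two : ∀ {n a b c} → Consecutiveℕ n a → Consecutiveℕ n b → a ≢ b →
  Consecutiveℕ n c → c ≡ a ⊎ c ≡ b
Consecutiveℕ-two (inj₁ refl) (inj₁ refl) a≢b _           = ⊥-elim (a≢b refl)
Consecutiveℕ-two (inj₂ refl) (inj₂ sb≡n) a≢b _           = ⊥-elim (a≢b (ℕ.suc-injective (sym sb≡n)))
Consecutiveℕ-two (inj₁ refl) (inj₂ refl) _   (inj₁ refl) = inj₁ refl
Consecutiveℕ-two (inj₁ refl) (inj₂ refl) _   (inj₂ sc≡b) = inj₂ (ℕ.suc-injective sc≡b)
Consecutiveℕ-two (inj₂ refl) (inj₁ refl) _   (inj₁ refl) = inj₂ refl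
Consecutiveℕ-two (inj₂ refl) (inj₁ refl) _   (inj₂ sc≡a) = inj₁ (ℕ.suc-injective sc≡a)

consecutive⇒ℕ : ∀ {k} (i j : Fin k) → consecutive i j ≡ true → Consecutiveℕ (toℕ i) (toℕ j)
consecutive⇒ℕ i j h = ⊎-map (ℕ.≡ᵇ⇒≡ _ _ ∘ ≡true⇒T) (ℕ.≡ᵇ⇒≡ _ _ ∘ ≡true⇒T) (∨-true⁻ h)

ℕ⇒consecutive : ∀ {k} (i j : Fin k) → Consecutiveℕ (toℕ i) (toℕ j) → consecutive i j ≡ true
ℕ⇒consecutive i j (inj₁ e) = ∨-trueˡ _ (T⇒≡true (ℕ.≡⇒≡ᵇ _ _ e))
ℕ⇒consecutive i j (inj₂ e) = ∨-trueʳ _ (T⇒≡true (ℕ.≡⇒≡ᵇ _ _ e))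

consecutive-two : ∀ {k} {i a b c : Fin k} → consecutive i a ≡ true → consecutive i b ≡ true → a ≢ b →
  consecutive i c ≡ true → c ≡ a ⊎ c ≡ b
consecutive-two {i = i} {a} {b} {c} ia ib a≢b ic =
  ⊎-map Fin.toℕ-injective Fin.toℕ-injective
    (Consecutiveℕ-two (consecutive⇒ℕ i a ia) (consecutive⇒ℕ i b ib) (a≢b ∘ Fin.toℕ-injective)
                      (consecutive⇒ℕ i c ic))

-- PunchInℕ j a a′ says that a′ = toℕ (punchIn j a): position a of a path from which position j
-- has been deleted sits at position a′ of the original path.
PunchInℕ : ℕ → ℕ → ℕ → Set
PunchInℕ j a a′ = (a < j × a′ ≡ a) ⊎ (j ≤ a × a′ ≡ suc a)

toℕ-punchIn : ∀ {n} (j : Fin (suc n)) (a : Fin n) → PunchInℕ (toℕ j) (toℕ a) (toℕ (punchIn j a))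
toℕ-punchIn zero    a       = inj₂ (z≤n , refl)
toℕ-punchIn (suc j) zero    = inj₁ (s≤s z≤n , refl)
toℕ-punchIn (suc j) (suc a) with toℕ-punchIn j a
... | inj₁ (a<j , e) = inj₁ (s≤s a<j , cong suc e)
... | inj₂ (j≤a , e) = inj₂ (s≤s j≤a , cong suc e)

punchInℕ-consecutive⁻ : ∀ {j a b a′ b′} → PunchInℕ j a a′ → PunchInℕ j b b′ →
  Consecutiveℕ a′ b′ → Consecutiveℕ a b
punchInℕ-consecutive⁻ (inj₁ (_ , refl)) (inj₁ (_ , refl)) c = c
punchInℕ-consecutive⁻ (inj₂ (_ , refl)) (inj₂ (_ , refl)) c = ⊎-map ℕ.suc-injective ℕ.suc-injective c
punchInℕ-consecutive⁻ (inj₁ (a<j , refl)) (inj₂ (j≤b , refl)) c =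
  ⊥-elim (straddle (<-≤-trans a<j j≤b) c)
  where
  straddle : ∀ {a b} → a < b → ¬ Consecutiveℕ a (suc b)
  straddle a<b (inj₁ e) = <-irrefl (ℕ.suc-injective e) a<b
  straddle a<b (inj₂ e) = <⇒≱ a<b (≤-trans (n≤1+n _) (≤-trans (n≤1+n _) (≤-reflexive e)))
punchInℕ-consecutive⁻ (inj₂ (j≤a , refl)) (inj₁ (b<j , refl)) c =
  swap (punchInℕ-consecutive⁻ (inj₁ (b<j , refl)) (inj₂ (j≤a , refl)) (swap c))

punchInℕ-across : ∀ {j a b a′ b′} → suc a′ ≡ j → suc j ≡ b′ →
  PunchInℕ j a a′ → PunchInℕ j b b′ → suc a ≡ b
punchInℕ-across refl _    (inj₂ (j≤a , refl)) _ = ⊥-elim (<-irrefl refl (≤-trans (s≤s (n≤1+n _)) j≤a))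
punchInℕ-across refl refl (inj₁ _) (inj₁ (b<j , refl)) = ⊥-elim (<-irrefl refl (<-trans (n<1+n _) b<j))
punchInℕ-across refl refl (inj₁ (_ , refl)) (inj₂ (_ , sb≡b′)) = ℕ.suc-injective sb≡b′

punchInℕ-bridge : ∀ {j a b a′ b′} → Consecutiveℕ j a′ → Consecutiveℕ j b′ → a′ ≢ b′ →
  PunchInℕ j a a′ → PunchInℕ j b b′ → Consecutiveℕ a b
punchInℕ-bridge (inj₁ refl)  (inj₁ refl)  a′≢b′ _ _ = ⊥-elim (a′≢b′ refl)
punchInℕ-bridge (inj₂ sa′≡j) (inj₂ sb′≡j) a′≢b′ _ _ =
  ⊥-elim (a′≢b′ (ℕ.suc-injective (trans sa′≡j (sym sb′≡j))))
punchInℕ-bridge (inj₂ sa′≡j) (inj₁ sj≡b′) _ pa pb = inj₁ (punchInℕ-across sa′≡j sj≡b′ pa pb)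
punchInℕ-bridge (inj₁ sj≡a′) (inj₂ sb′≡j) _ pa pb = inj₂ (punchInℕ-across sb′≡j sj≡a′ pb pa)

punchInℕ-split : ∀ {j a b a′ b′} → PunchInℕ j a a′ → PunchInℕ j b b′ → suc a ≡ b →
  ¬ Consecutiveℕ a′ b′ → suc a′ ≡ j × suc j ≡ b′
punchInℕ-split (inj₁ (_ , refl)) (inj₁ (_ , refl)) sa≡b ¬c = ⊥-elim (¬c (inj₁ sa≡b))
punchInℕ-split (inj₂ (_ , refl)) (inj₂ (_ , refl)) sa≡b ¬c = ⊥-elim (¬c (inj₁ (cong suc sa≡b)))
punchInℕ-split (inj₁ (a<j , refl)) (inj₂ (j≤b , refl)) refl _ with refl ← ≤-antisym a<j j≤b = refl , refl
punchInℕ-split (inj₂ (j≤a , refl)) (inj₁ (b<j , refl)) refl _ =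
  ⊥-elim (<-irrefl refl (≤-trans b<j (≤-trans j≤a (n≤1+n _))))

punchInℕ-gap : ∀ {j a b a′ b′} → PunchInℕ j a a′ → PunchInℕ j b b′ → Consecutiveℕ a b →
  ¬ Consecutiveℕ a′ b′ → Consecutiveℕ j a′ × Consecutiveℕ j b′
punchInℕ-gap pa pb (inj₁ sa≡b) ¬c with sa′≡j , sj≡b′ ← punchInℕ-split pa pb sa≡b ¬c =
  inj₂ sa′≡j , inj₁ sj≡b′
punchInℕ-gap pa pb (inj₂ sb≡a) ¬c with sb′≡j , sj≡a′ ← punchInℕ-split pb pa sb≡a (¬c ∘ swap) =
  inj₁ sj≡a′ , inj₂ sb′≡j

punchInℕ-first : ∀ {j k a′} → PunchInℕ j 0 a′ → Consecutiveℕ k j → a′ ≡ 0 ⊎ a′ ≡ k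
punchInℕ-first (inj₁ (_ , a′≡0)) _ = inj₁ a′≡0
punchInℕ-first (inj₂ (z≤n , refl)) (inj₂ refl) = inj₂ refl

punchInℕ-last : ∀ {j k l a′} → PunchInℕ j l a′ → j ≤ suc l → k ≤ suc l → Consecutiveℕ k j →
  a′ ≡ suc l ⊎ a′ ≡ k
punchInℕ-last (inj₂ (_ , a′≡sl)) _ _ _ = inj₁ a′≡sl
punchInℕ-last (inj₁ (l<j , refl)) j≤sl _ (inj₁ sk≡j)
  with refl ← ≤-antisym j≤sl l<j = inj₂ (sym (ℕ.suc-injective sk≡j))
punchInℕ-last (inj₁ (l<j , refl)) j≤sl k≤sl (inj₂ refl)
  with refl ← ≤-antisym j≤sl l<j = ⊥-elim (<-irrefl refl k≤sl)

record InducedPath (G : Graph) (k : ℕ) (v : Fin k → Vertex G) : Set where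
  field
    injective       : ∀ i j → v i ≡ v j → i ≡ j
    adj≡consecutive : ∀ i j → adj G (v i) (v j) ≡ consecutive i j
open InducedPath

distinct-entry : ∀ {n k} (v : Fin k → Fin n) → (∀ i j → v i ≡ v j → i ≡ j) →
  ∀ i j → not (v i ==ᶠ v j) ∨ (i ==ᶠ j) ≡ true
distinct-entry v inj i j with i ==ᶠ j in i=j
... | true  = ∨-trueʳ (not (v i ==ᶠ v j)) refl
... | false = ∨-trueˡ false (not-true⁺ (≢⇒==ᶠ-false (λ vi≡vj → ==ᶠ-false⇒≢ i=j (inj i j vi≡vj))))

isInducedPath-sound : ∀ G k v → isInducedPath G k v ≡ true → InducedPath G k v
isInducedPath-sound G k v h = record { injective = inj′ ; adj≡consecutive = agree }
  where
  inj′ : ∀ i j → v i ≡ v j → i ≡ j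
  inj′ i j vi≡vj
    with ∨-true⁻ (∧-trueˡ (all-true⁻ _ (all-true⁻ _ h (∈-allFin i)) (∈-allFin j)))
  ... | inj₁ vi≢vj = ⊥-elim (==ᶠ-false⇒≢ (not-true⁻ vi≢vj) vi≡vj)
  ... | inj₂ i≡j   = ==ᶠ⇒≡ i≡j
  agree : ∀ i j → adj G (v i) (v j) ≡ consecutive i j
  agree i j
    with not (v i ==ᶠ v j) ∨ (i ==ᶠ j) | adj G (v i) (v j)
       | all-true⁻ _ (all-true⁻ _ h (∈-allFin i)) (∈-allFin j)
  ... | true | true  | h′ = sym h′
  ... | true | false | h′ = sym (not-true⁻ h′)

isInducedPath-complete : ∀ G k v → InducedPath G k v → isInducedPath G k v ≡ true
isInducedPath-complete G k v ip with isInducedPath G k v in eq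
... | true = refl
... | false
  with i , _ , row-false ← all-false⁻ _ (allFin k) eq
  with j , _ , entry-false ← all-false⁻ _ (allFin k) row-false
  with not (v i ==ᶠ v j) ∨ (i ==ᶠ j) | distinct-entry v (injective ip) i j
       | adj G (v i) (v j) | adj≡consecutive ip i j
... | _ | refl | true  | a≡c = ⊥-elim (true≢false (trans a≡c entry-false))
... | _ | refl | false | a≡c = ⊥-elim (true≢false (trans (cong not a≡c) entry-false))

InducedPath-resp-≗ : ∀ {G k} {v w : Fin k → Vertex G} → w ≗ v → InducedPath G k v → InducedPath G k w
InducedPath-resp-≗ {G} w≗v ip = record
  { injective       = λ i j wi≡wj → injective ip i j (trans (sym (w≗v i)) (trans wi≡wj (w≗v j)))
  ; adj≡consecutive = λ i j → trans (cong₂ (adj G) (w≗v i) (w≗v j)) (adj≡consecutive ip i j)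
  }

record CoveringPath (G : Graph) (Z S : VSet G) : Set where
  constructor coveringPath
  field
    Z⊆S        : ∀ u → Z u ≡ true → S u ≡ true
    len        : ℕ
    len<order  : len < order G
    vertex     : Fin (suc len) → Vertex G
    induced    : InducedPath G (suc len) vertex
    first∈Z    : Z (vertex zero) ≡ true
    last∈Z     : Z (vertex (fromℕ len)) ≡ true
    vertex∈S   : ∀ i → S (vertex i) ≡ true
    S⊆vertices : ∀ u → S u ≡ true → ∃ λ i → vertex i ≡ u
open CoveringPath

isZCoveringPathSet-sound : ∀ G Z S → isZCoveringPathSet G Z S ≡ true → CoveringPath G Z S
isZCoveringPathSet-sound G Z S h
  with m , m∈upTo , h₁ ← any-true⁻ _ (upTo (order G)) (∧-trueʳ h)
  with v , h₂ ← anyFun-true⁻ (suc m) (allFin (order G)) _ h₁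
  with ip , h₃ ← ∧-true⁻ (isInducedPath G (suc m) v) h₂
  with z₀ , h₄ ← ∧-true⁻ (Z (v zero)) h₃
  with zₘ , h₅ ← ∧-true⁻ (Z (v (fromℕ m))) h₄
  with v∈S , S⊆v ← ∧-true⁻ (all (λ i → S (v i)) (allFin (suc m))) h₅ = record
  { Z⊆S        = λ u → from-not-or (all-true⁻ _ (∧-trueˡ h) (∈-allFin u))
  ; len        = m
  ; len<order  = ∈-upTo⁻ m∈upTo
  ; vertex     = v
  ; induced    = isInducedPath-sound G (suc m) v ip
  ; first∈Z    = z₀
  ; last∈Z     = zₘ
  ; vertex∈S   = λ i → all-true⁻ _ v∈S (∈-allFin i)
  ; S⊆vertices = λ u Su → covered u (from-not-or (all-true⁻ _ S⊆v (∈-allFin u)) Su)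
  }
  where
  from-not-or : ∀ {a b} → not a ∨ b ≡ true → a ≡ true → b ≡ true
  from-not-or h′ refl = h′
  covered : ∀ u → any (λ i → v i ==ᶠ u) (allFin (suc m)) ≡ true → ∃ λ i → v i ≡ u
  covered u h′ with i , _ , vi=u ← any-true⁻ _ (allFin (suc m)) h′ = i , ==ᶠ⇒≡ vi=u

isZCoveringPathSet-complete : ∀ G Z S → CoveringPath G Z S → isZCoveringPathSet G Z S ≡ true
isZCoveringPathSet-complete G Z S c =
  ∧-true⁺ (all-true⁺ _ (allFin (order G)) (λ u _ → to-not-or (Z⊆S c u)))
          (any-true⁺ _ (∈-upTo⁺ (len<order c))
            (anyFun-true⁺ (suc (len c)) (allFin (order G)) _ (vertex c) (λ _ → ∈-allFin _) conditions))
  where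
  to-not-or : ∀ {a b} → (a ≡ true → b ≡ true) → not a ∨ b ≡ true
  to-not-or {false} _   = refl
  to-not-or {true}  a⇒b = a⇒b refl
  conditions : ∀ g → g ≗ vertex c →
    isInducedPath G (suc (len c)) g ∧ Z (g zero) ∧ Z (g (fromℕ (len c))) ∧
    all (λ i → S (g i)) (allFin (suc (len c))) ∧
    all (λ u → not (S u) ∨ any (λ i → g i ==ᶠ u) (allFin (suc (len c)))) (allFin (order G)) ≡ true
  conditions g g≗v =
    ∧-true⁺ (isInducedPath-complete G _ g (InducedPath-resp-≗ g≗v (induced c)))
   (∧-true⁺ (trans (cong Z (g≗v zero)) (first∈Z c))
   (∧-true⁺ (trans (cong Z (g≗v (fromℕ (len c)))) (last∈Z c))
   (∧-true⁺ (all-true⁺ _ (allFin _) (λ i _ → trans (cong S (g≗v i)) (vertex∈S c i)))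
            (all-true⁺ _ (allFin (order G)) (λ u _ → to-not-or λ Su →
               let i , vi≡u = S⊆vertices c u Su in
               any-true⁺ _ (∈-allFin i) (≡⇒==ᶠ (trans (g≗v i) vi≡u)))))))

CoveringPath-resp-≗ : ∀ {G Z} {S S′ : VSet G} → S ≗ S′ → CoveringPath G Z S → CoveringPath G Z S′
CoveringPath-resp-≗ S≗S′ c = record
  { Z⊆S        = λ u Zu → trans (sym (S≗S′ u)) (Z⊆S c u Zu)
  ; len        = len c
  ; len<order  = len<order c
  ; vertex     = vertex c
  ; induced    = induced c
  ; first∈Z    = first∈Z c
  ; last∈Z     = last∈Z c
  ; vertex∈S   = λ i → trans (sym (S≗S′ _)) (vertex∈S c i)
  ; S⊆vertices = λ u S′u → S⊆vertices c u (trans (S≗S′ u) S′u)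
  }

isZCoveringPathSet-cong : ∀ G Z {S S′ : VSet G} → S ≗ S′ →
  isZCoveringPathSet G Z S ≡ isZCoveringPathSet G Z S′
isZCoveringPathSet-cong G Z S≗S′ = true⇔⇒≡ (transport S≗S′) (transport (sym ∘ S≗S′))
  where
  transport : ∀ {S S′} → S ≗ S′ → isZCoveringPathSet G Z S ≡ true → isZCoveringPathSet G Z S′ ≡ true
  transport e h =
    isZCoveringPathSet-complete G Z _ (CoveringPath-resp-≗ e (isZCoveringPathSet-sound G Z _ h))

zDegree : (G : Graph) → VSet G → Vertex G → ℕ
zDegree G Z v = countFin (order G) (λ u → Z u ∧ adj G v u)

module _ {G : Graph} {Z S : VSet G} (c : CoveringPath G Z S) where

  covering-path-index : ∀ u → Z u ≡ true → ∃ λ j → vertex c j ≡ u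
  covering-path-index u Zu = S⊆vertices c u (Z⊆S c u Zu)

  covering-path-Z-neighbour : ∀ {i j u} → vertex c j ≡ u → (Z u ∧ adj G (vertex c i) u) ≡ true →
    consecutive i j ≡ true
  covering-path-Z-neighbour {i} {j} {u} refl h =
    trans (sym (adj≡consecutive (induced c) i j)) (∧-trueʳ {Z u} h)

  covering-path-avoids-heavy : ∀ {x} → 3 ≤ zDegree G Z x → ∀ i → vertex c i ≢ x
  covering-path-avoids-heavy {x} heavy i refl
    with a , b , d , Za , Zb , Zd , a≢b , a≢d , b≢d ← countFin-three (order G) _ heavy
    with ja , refl ← covering-path-index a (∧-trueˡ Za)
    with jb , refl ← covering-path-index b (∧-trueˡ Zb)
    with jd , refl ← covering-path-index d (∧-trueˡ Zd)
    with consecutive-two (covering-path-Z-neighbour refl Za) (covering-path-Z-neighbour refl Zb)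
                         (λ ja≡jb → a≢b (cong (vertex c) ja≡jb)) (covering-path-Z-neighbour refl Zd)
  ... | inj₁ jd≡ja = a≢d (cong (vertex c) (sym jd≡ja))
  ... | inj₂ jd≡jb = b≢d (cong (vertex c) (sym jd≡jb))

record IsPath (G : Graph) (k : ℕ) (f : Fin (suc k) → Vertex G) : Set where
  field
    distinct : ∀ i j → f i ≡ f j → i ≡ j
    steps    : ∀ (i : Fin k) → adj G (f (inject₁ i)) (f (suc i)) ≡ true
open IsPath

closePath : ∀ {G n} (f : Fin (suc (suc (suc n))) → Vertex G) → IsPath G (suc (suc n)) f →
  adj G (f (fromℕ (suc (suc n)))) (f zero) ≡ true → Cycle G
closePath {n = n} f p closing-edge = record
  { m = n ; vtx = f ; inj = distinct p ; step = steps p ; closing = closing-edge }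

IsPath-snoc : ∀ {G k f x} → IsPath G k f → (∀ i → f i ≢ x) → adj G (f (fromℕ k)) x ≡ true →
  IsPath G (suc k) (snoc f x)
IsPath-snoc {G} {k} {f} {x} p f≢x last-edge = record
  { distinct = snoc-injective f x (distinct p) f≢x ; steps = steps′ }
  where
  steps′ : ∀ (i : Fin (suc k)) → adj G (snoc f x (inject₁ i)) (snoc f x (suc i)) ≡ true
  steps′ i with inject₁⊎fromℕ i
  ... | inj₁ (i′ , refl) = subst₂ (λ u v → adj G u v ≡ true)
                             (sym (snoc-inject₁ f x (inject₁ i′))) (sym (snoc-inject₁ f x (suc i′)))
                             (steps p i′)
  ... | inj₂ refl        = subst₂ (λ u v → adj G u v ≡ true)
                             (sym (snoc-inject₁ f x (fromℕ k))) (sym (snoc-last f x)) last-edge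

snoc-last-adj : ∀ {G n} (g : Fin (suc n) → Vertex G) {x y} → adj G x y ≡ true →
  adj G (snoc g x (fromℕ (suc n))) y ≡ true
snoc-last-adj {G} g {x} {y} xy = subst (λ u → adj G u y ≡ true) (sym (snoc-last g x)) xy

closeSnoc : ∀ {G n} (g : Fin (suc (suc n)) → Vertex G) {x} → IsPath G (suc (suc n)) (snoc g x) →
  adj G (g zero) x ≡ true → Cycle G
closeSnoc {G} g {x} p gx =
  closePath (snoc g x) p (snoc-last-adj {G} g (trans (Graph.sym G x (g zero)) gx))

next : ∀ {n} → Fin (suc n) → Fin (suc n)
next = snoc suc zero

cycle-next : ∀ {G} (C : Cycle G) i → adj G (vtx C i) (vtx C (next i)) ≡ true
cycle-next {G} C i with inject₁⊎fromℕ i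
... | inj₁ (i′ , refl) = subst (λ j → adj G (vtx C (inject₁ i′)) (vtx C j) ≡ true)
                           (sym (snoc-inject₁ suc zero i′)) (step C i′)
... | inj₂ refl        = subst (λ j → adj G (vtx C (fromℕ _)) (vtx C j) ≡ true)
                           (sym (snoc-last suc zero)) (closing C)

rotate : ∀ {G} → Cycle G → Cycle G
rotate {G} C = record
  { m       = m C
  ; vtx     = vtx C ∘ next
  ; inj     = λ i j e → snoc-injective suc zero (λ _ _ → Fin.suc-injective) (λ _ ()) i j (inj C _ _ e)
  ; step    = λ i → subst (λ j → adj G (vtx C j) (vtx C (next (suc i))) ≡ true)
                      (sym (snoc-inject₁ suc zero i)) (cycle-next C (suc i))
  ; closing = subst (λ j → adj G (vtx C j) (vtx C (suc zero)) ≡ true)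
                (sym (snoc-last suc zero)) (cycle-next C zero)
  }

rotate-to-last : ∀ {G} n (C : Cycle G) K → toℕ K ≡ n →
  Σ (Cycle G) λ D → vtx D (fromℕ (suc (suc (m D)))) ≡ vtx C K × ∀ i → ∃ λ j → vtx D i ≡ vtx C j
rotate-to-last zero C zero _ = rotate C , cong (vtx C) (snoc-last suc zero) , λ i → next i , refl
rotate-to-last (suc n) C (suc K) e
  with D , last≡ , D⊆ ← rotate-to-last n (rotate C) (inject₁ K)
                           (trans (Fin.toℕ-inject₁ K) (ℕ.suc-injective e)) =
  D , trans last≡ (cong (vtx C) (snoc-inject₁ suc zero K)) , λ i → next (proj₁ (D⊆ i)) , proj₂ (D⊆ i)

-- Isolating a vertex

hasNeighbour : ∀ {n} → (Fin n → Fin n → Bool) → Fin n → Bool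
hasNeighbour {n} a u = any (a u) (allFin n)

nonIsolated : Graph → ℕ
nonIsolated G = countFin (order G) (hasNeighbour (adj G))

hasNeighbour-< : ∀ {n} (a b : Fin n → Fin n → Bool) →
  (∀ u v → a u v ≡ true → ∃ λ w → b u w ≡ true) →
  ∀ x y → (∀ v → a x v ≢ true) → b x y ≡ true →
  countFin n (hasNeighbour a) < countFin n (hasNeighbour b)
hasNeighbour-< {n} a b a⇒b x y x-isolated bxy =
  countFin-mono-< n a⊆b x (¬-not x-no-neighbour) (any-true⁺ _ (∈-allFin y) bxy)
  where
  a⊆b : ∀ u → hasNeighbour a u ≡ true → hasNeighbour b u ≡ true
  a⊆b u h with v , _ , auv ← any-true⁻ _ (allFin n) h
          with w , buw ← a⇒b u v auv = any-true⁺ _ (∈-allFin w) buw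
  x-no-neighbour : hasNeighbour a x ≢ true
  x-no-neighbour h with v , _ , axv ← any-true⁻ _ (allFin n) h = x-isolated v axv

isolateAdj : (G : Graph) → Vertex G → Vertex G → Vertex G → Bool
isolateAdj G x a b = adj G a b ∧ not (a ==ᶠ x) ∧ not (b ==ᶠ x)

isolate : (G : Graph) → Vertex G → Graph
isolate G x = record
  { order  = order G
  ; adj    = isolateAdj G x
  ; sym    = λ a b → cong₂ _∧_ (Graph.sym G a b) (∧-comm (not (a ==ᶠ x)) (not (b ==ᶠ x)))
  ; irrefl = λ v → cong (_∧ (not (v ==ᶠ x) ∧ not (v ==ᶠ x))) (irrefl G v)
  }

module Isolation {G : Graph} {x : Vertex G} where

  isolate-adj⁻ : ∀ {a b} → adj (isolate G x) a b ≡ true → adj G a b ≡ true × a ≢ x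
  isolate-adj⁻ {a} {b} h = ∧-trueˡ h , ==ᶠ-false⇒≢ (not-true⁻ (∧-trueˡ (∧-trueʳ {adj G a b} h)))

  isolate-adj-away : ∀ {a b} → a ≢ x → b ≢ x → adj (isolate G x) a b ≡ adj G a b
  isolate-adj-away {a} {b} a≢x b≢x rewrite ≢⇒==ᶠ-false a≢x | ≢⇒==ᶠ-false b≢x = ∧-identityʳ (adj G a b)

  isolate-cycle : Cycle (isolate G x) → Cycle G
  isolate-cycle C = record
    { m = m C ; vtx = vtx C ; inj = inj C
    ; step = λ i → proj₁ (isolate-adj⁻ (step C i)) ; closing = proj₁ (isolate-adj⁻ (closing C)) }

  isolate-cycle-avoids : ∀ (C : Cycle (isolate G x)) i → vtx C i ≢ x
  isolate-cycle-avoids C i = proj₂ (isolate-adj⁻ (cycle-next C i))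

  isolate-plantation : ∀ {s Z} → Plantation s G Z → Plantation s (isolate G x) Z
  isolate-plantation {s} (sO-free , hitting) = sO-free′ , hitting ∘ isolate-cycle
    where
    sO-free′ : SOFree s (isolate G x)
    sO-free′ (Cs , anticomplete) = sO-free (isolate-cycle ∘ Cs , λ a b a≢b i j →
      proj₁ (anticomplete a b a≢b i j) ,
      trans (sym (isolate-adj-away (isolate-cycle-avoids (Cs a) i) (isolate-cycle-avoids (Cs b) j)))
            (proj₂ (anticomplete a b a≢b i j)))

  isolate-covering : ∀ {Z S} → 3 ≤ zDegree G Z x → CoveringPath G Z S → CoveringPath (isolate G x) Z S
  isolate-covering heavy c = record
    { Z⊆S = Z⊆S c ; len = len c ; len<order = len<order c ; vertex = vertex c
    ; induced = record
      { injective = injective (induced c)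
      ; adj≡consecutive = λ i j →
          trans (isolate-adj-away (avoids i) (avoids j)) (adj≡consecutive (induced c) i j)
      }
    ; first∈Z = first∈Z c ; last∈Z = last∈Z c ; vertex∈S = vertex∈S c ; S⊆vertices = S⊆vertices c
    }
    where
    avoids : ∀ i → vertex c i ≢ x
    avoids = covering-path-avoids-heavy c heavy

  isolate-nPaths : ∀ {Z} → 3 ≤ zDegree G Z x → nPaths G Z ≤ nPaths (isolate G x) Z
  isolate-nPaths {Z} heavy = countFun-mono (order G) _ λ S h →
    isZCoveringPathSet-complete (isolate G x) Z S
      (isolate-covering heavy (isZCoveringPathSet-sound G Z S h))

  isolate-nonIsolated : ∀ {y} → adj G x y ≡ true → nonIsolated (isolate G x) < nonIsolated G
  isolate-nonIsolated {y} xy = hasNeighbour-< (adj (isolate G x)) (adj G)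
    (λ u v h → v , proj₁ (isolate-adj⁻ h)) x y (λ v h → proj₂ (isolate-adj⁻ h) refl) xy

-- Contracting an edge inside Z

module _ (G : Graph) (z₁ z₂ : Vertex G) where

  ContractedEdge : Vertex G → Vertex G → Set
  ContractedEdge a b = adj G a b ≡ true ⊎ (a ≡ z₁ × adj G z₂ b ≡ true) ⊎ (b ≡ z₁ × adj G a z₂ ≡ true)

  -- z₂ is merged into z₁ but kept as an isolated vertex, so the vertex set does not change.
  contractAdj : Vertex G → Vertex G → Bool
  contractAdj a b = not (a ==ᶠ z₂) ∧ not (b ==ᶠ z₂) ∧ not (a ==ᶠ b) ∧
    (adj G a b ∨ ((a ==ᶠ z₁) ∧ adj G z₂ b) ∨ ((b ==ᶠ z₁) ∧ adj G a z₂))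

  contractAdj⁻ : ∀ a b → contractAdj a b ≡ true → a ≢ z₂ × b ≢ z₂ × a ≢ b × ContractedEdge a b
  contractAdj⁻ a b h
    with a≠z₂ , h₁ ← ∧-true⁻ (not (a ==ᶠ z₂)) h
    with b≠z₂ , h₂ ← ∧-true⁻ (not (b ==ᶠ z₂)) h₁
    with a≠b , h₃ ← ∧-true⁻ (not (a ==ᶠ b)) h₂ =
    ≢ a≠z₂ , ≢ b≠z₂ , ≢ a≠b , edge (∨-true⁻ h₃)
    where
    ≢ : ∀ {u v : Vertex G} → not (u ==ᶠ v) ≡ true → u ≢ v
    ≢ h′ = ==ᶠ-false⇒≢ (not-true⁻ h′)
    edge : adj G a b ≡ true ⊎ ((a ==ᶠ z₁) ∧ adj G z₂ b ∨ (b ==ᶠ z₁) ∧ adj G a z₂) ≡ true →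
      ContractedEdge a b
    edge (inj₁ ab) = inj₁ ab
    edge (inj₂ h₄) with ∨-true⁻ h₄
    ... | inj₁ h₅ = inj₂ (inj₁ (==ᶠ⇒≡ (∧-trueˡ h₅) , ∧-trueʳ {a ==ᶠ z₁} h₅))
    ... | inj₂ h₅ = inj₂ (inj₂ (==ᶠ⇒≡ (∧-trueˡ h₅) , ∧-trueʳ {b ==ᶠ z₁} h₅))

  contractAdj⁺ : ∀ a b → a ≢ z₂ → b ≢ z₂ → a ≢ b → ContractedEdge a b → contractAdj a b ≡ true
  contractAdj⁺ a b a≢z₂ b≢z₂ a≢b e =
    ∧-true⁺ (≢⇒ a≢z₂) (∧-true⁺ (≢⇒ b≢z₂) (∧-true⁺ (≢⇒ a≢b) (edge e)))
    where
    ≢⇒ : ∀ {u v : Vertex G} → u ≢ v → not (u ==ᶠ v) ≡ true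
    ≢⇒ u≢v = not-true⁺ (≢⇒==ᶠ-false u≢v)
    edge : ContractedEdge a b →
      (adj G a b ∨ ((a ==ᶠ z₁) ∧ adj G z₂ b) ∨ ((b ==ᶠ z₁) ∧ adj G a z₂)) ≡ true
    edge (inj₁ ab)                = ∨-trueˡ _ ab
    edge (inj₂ (inj₁ (a≡z₁ , e))) = ∨-trueʳ (adj G a b) (∨-trueˡ _ (∧-true⁺ (≡⇒==ᶠ a≡z₁) e))
    edge (inj₂ (inj₂ (b≡z₁ , e))) = ∨-trueʳ (adj G a b) (∨-trueʳ _ (∧-true⁺ (≡⇒==ᶠ b≡z₁) e))

  ContractedEdge-sym : ∀ {a b} → ContractedEdge a b → ContractedEdge b a
  ContractedEdge-sym {a} {b} (inj₁ ab)        = inj₁ (trans (Graph.sym G b a) ab)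
  ContractedEdge-sym {a} {b} (inj₂ (inj₁ (a≡z₁ , e))) = inj₂ (inj₂ (a≡z₁ , trans (Graph.sym G b z₂) e))
  ContractedEdge-sym {a} {b} (inj₂ (inj₂ (b≡z₁ , e))) = inj₂ (inj₁ (b≡z₁ , trans (Graph.sym G z₂ a) e))

  contractAdj-sym : ∀ a b → contractAdj a b ≡ contractAdj b a
  contractAdj-sym a b = true⇔⇒≡ (flip {a} {b}) (flip {b} {a})
    where
    flip : ∀ {u v} → contractAdj u v ≡ true → contractAdj v u ≡ true
    flip {u} {v} h with u≢z₂ , v≢z₂ , u≢v , e ← contractAdj⁻ u v h =
      contractAdj⁺ v u v≢z₂ u≢z₂ (u≢v ∘ sym) (ContractedEdge-sym e)

  contract : Graph
  contract = record
    { order  = order G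
    ; adj    = contractAdj
    ; sym    = contractAdj-sym
    ; irrefl = λ v → ¬-not (λ h → proj₁ (proj₂ (proj₂ (contractAdj⁻ v v h))) refl)
    }

module Contraction {G : Graph} {z₁ z₂ : Vertex G} (z₁z₂ : adj G z₁ z₂ ≡ true) where

  H : Graph
  H = contract G z₁ z₂

  z₂z₁ : adj G z₂ z₁ ≡ true
  z₂z₁ = trans (Graph.sym G z₂ z₁) z₁z₂

  z₁≢z₂ : z₁ ≢ z₂
  z₁≢z₂ refl = true≢false (trans (sym z₁z₂) (irrefl G z₁))

  H-adj-avoids-z₂ : ∀ a b → adj H a b ≡ true → a ≢ z₂
  H-adj-avoids-z₂ a b h = proj₁ (contractAdj⁻ G z₁ z₂ a b h)

  H-cycle-avoids-z₂ : ∀ (C : Cycle H) i → vtx C i ≢ z₂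
  H-cycle-avoids-z₂ C i = H-adj-avoids-z₂ (vtx C i) (vtx C (next i)) (cycle-next C i)

  H-adj-away-from-z₁ : ∀ a b → a ≢ z₁ → b ≢ z₁ → adj H a b ≡ true → adj G a b ≡ true
  H-adj-away-from-z₁ a b a≢z₁ b≢z₁ h with contractAdj⁻ G z₁ z₂ a b h
  ... | _ , _ , _ , inj₁ ab                   = ab
  ... | _ , _ , _ , inj₂ (inj₁ (a≡z₁ , _)) = ⊥-elim (a≢z₁ a≡z₁)
  ... | _ , _ , _ , inj₂ (inj₂ (b≡z₁ , _)) = ⊥-elim (b≢z₁ b≡z₁)

  H-adj-into-z₁ : ∀ a → adj H a z₁ ≡ true → adj G a z₁ ≡ true ⊎ adj G a z₂ ≡ true
  H-adj-into-z₁ a h with contractAdj⁻ G z₁ z₂ a z₁ h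
  ... | _ , _ , _   , inj₁ az₁                  = inj₁ az₁
  ... | _ , _ , a≢z₁ , inj₂ (inj₁ (a≡z₁ , _)) = ⊥-elim (a≢z₁ a≡z₁)
  ... | _ , _ , _   , inj₂ (inj₂ (_ , az₂))   = inj₂ az₂

  shadow : Vertex G → Vertex G
  shadow u = if u ==ᶠ z₂ then z₁ else u

  shadow-z₂ : shadow z₂ ≡ z₁
  shadow-z₂ rewrite ≡⇒==ᶠ {i = z₂} refl = refl

  shadow-other : ∀ {u} → u ≢ z₂ → shadow u ≡ u
  shadow-other u≢z₂ rewrite ≢⇒==ᶠ-false u≢z₂ = refl

  shadow-adj : ∀ {u v} → adj G u v ≡ true → shadow u ≢ shadow v → adj H (shadow u) (shadow v) ≡ true
  shadow-adj {u} {v} uv su≢sv with u ≟ z₂ | v ≟ z₂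
  ... | yes refl | yes refl = ⊥-elim (su≢sv refl)
  ... | yes refl | no v≢z₂  = contractAdj⁺ G z₁ z₂ z₁ v z₁≢z₂ v≢z₂ su≢sv (inj₂ (inj₁ (refl , uv)))
  ... | no u≢z₂  | yes refl = contractAdj⁺ G z₁ z₂ u z₁ u≢z₂ z₁≢z₂ su≢sv (inj₂ (inj₂ (refl , uv)))
  ... | no u≢z₂  | no v≢z₂  = contractAdj⁺ G z₁ z₂ u v u≢z₂ v≢z₂ su≢sv (inj₁ uv)

  shadow-∖ : ∀ {Z : VSet G} {u} → Z z₁ ≡ true → Z u ≡ true → (Z ∖ z₂) (shadow u) ≡ true
  shadow-∖ {Z} {u} Zz₁ Zu with u ≟ z₂
  ... | yes refl = ∖-true⁺ {S = Z} Zz₁ z₁≢z₂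
  ... | no u≢z₂  = ∖-true⁺ {S = Z} Zu u≢z₂

  ShadowIn : Cycle H → Vertex G → Set
  ShadowIn C u = ∃ λ j → shadow u ≡ vtx C j

  Shadowed : Cycle H → Cycle G → Set
  Shadowed C D = ∀ i → ShadowIn C (vtx D i)

  module _ (D : Cycle H) (last≡z₁ : vtx D (fromℕ (suc (suc (m D)))) ≡ z₁) where

    arc : Fin (suc (suc (m D))) → Vertex G
    arc = vtx D ∘ inject₁

    arc≢z₁ : ∀ j → arc j ≢ z₁
    arc≢z₁ j e = Fin.fromℕ≢inject₁ (inj D _ _ (trans last≡z₁ (sym e)))

    arc≢z₂ : ∀ j → arc j ≢ z₂
    arc≢z₂ j = H-cycle-avoids-z₂ D (inject₁ j)

    arc-path : IsPath G (suc (m D)) arc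
    arc-path = record
      { distinct = λ i j e → Fin.inject₁-injective (inj D _ _ e)
      ; steps    = λ i →
          H-adj-away-from-z₁ _ _ (arc≢z₁ (inject₁ i)) (arc≢z₁ (suc i)) (step D (inject₁ i))
      }

    arc-into-z₁ : adj G (arc (fromℕ (suc (m D)))) z₁ ≡ true ⊎ adj G (arc (fromℕ (suc (m D)))) z₂ ≡ true
    arc-into-z₁ = H-adj-into-z₁ _
      (subst (λ v → adj H (arc (fromℕ (suc (m D)))) v ≡ true) last≡z₁ (step D (fromℕ (suc (m D)))))

    arc-out-of-z₁ : adj G (arc zero) z₁ ≡ true ⊎ adj G (arc zero) z₂ ≡ true
    arc-out-of-z₁ = H-adj-into-z₁ _
      (trans (Graph.sym H (arc zero) z₁) (subst (λ v → adj H v (arc zero) ≡ true) last≡z₁ (closing D)))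

    arc-shadowed : ∀ j → ShadowIn D (arc j)
    arc-shadowed j = inject₁ j , shadow-other (arc≢z₂ j)

    z₁-shadowed : ShadowIn D z₁
    z₁-shadowed = fromℕ _ , trans (shadow-other z₁≢z₂) (sym last≡z₁)

    z₂-shadowed : ShadowIn D z₂
    z₂-shadowed = fromℕ _ , trans shadow-z₂ (sym last≡z₁)

    -- The edges of D at z₁ lift to edges at z₁ or at z₂; closing the arc through the
    -- corresponding one or two of z₁, z₂ gives a cycle of G.
    close-arc : adj G (arc (fromℕ (suc (m D)))) z₁ ≡ true ⊎ adj G (arc (fromℕ (suc (m D)))) z₂ ≡ true →
                adj G (arc zero) z₁ ≡ true ⊎ adj G (arc zero) z₂ ≡ true → Σ (Cycle G) (Shadowed D)
    close-arc (inj₁ in₁) (inj₁ out₁) =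
      closeSnoc arc (IsPath-snoc arc-path arc≢z₁ in₁) out₁ ,
      snoc-all {P = ShadowIn D} arc-shadowed z₁-shadowed
    close-arc (inj₁ in₁) (inj₂ out₂) =
      closeSnoc (snoc arc z₁)
        (IsPath-snoc (IsPath-snoc arc-path arc≢z₁ in₁) (snoc-all {P = _≢ z₂} arc≢z₂ z₁≢z₂)
                     (snoc-last-adj {G} arc z₁z₂))
        out₂ ,
      snoc-all {P = ShadowIn D} (snoc-all {P = ShadowIn D} arc-shadowed z₁-shadowed) z₂-shadowed
    close-arc (inj₂ in₂) (inj₁ out₁) =
      closeSnoc (snoc arc z₂)
        (IsPath-snoc (IsPath-snoc arc-path arc≢z₂ in₂) (snoc-all {P = _≢ z₁} arc≢z₁ (z₁≢z₂ ∘ sym))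
                     (snoc-last-adj {G} arc z₂z₁))
        out₁ ,
      snoc-all {P = ShadowIn D} (snoc-all {P = ShadowIn D} arc-shadowed z₂-shadowed) z₁-shadowed
    close-arc (inj₂ in₂) (inj₂ out₂) =
      closeSnoc arc (IsPath-snoc arc-path arc≢z₂ in₂) out₂ ,
      snoc-all {P = ShadowIn D} arc-shadowed z₂-shadowed

    lift-cycle-at-z₁ : Σ (Cycle G) (Shadowed D)
    lift-cycle-at-z₁ = close-arc arc-into-z₁ arc-out-of-z₁

  lift-cycle : (C : Cycle H) → Σ (Cycle G) (Shadowed C)
  lift-cycle C with Fin.any? (λ K → vtx C K ≟ z₁)
  ... | yes (K , CK≡z₁)
    with D , last≡CK , D⊆C ← rotate-to-last (toℕ K) C K refl
    with E , E↦D ← lift-cycle-at-z₁ D (trans last≡CK CK≡z₁) =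
    E , λ i → proj₁ (D⊆C (proj₁ (E↦D i))) , trans (proj₂ (E↦D i)) (proj₂ (D⊆C (proj₁ (E↦D i))))
  ... | no C∌z₁ = record
    { m       = m C
    ; vtx     = vtx C
    ; inj     = inj C
    ; step    = λ i → H-adj-away-from-z₁ _ _ (avoids _) (avoids _) (step C i)
    ; closing = H-adj-away-from-z₁ _ _ (avoids _) (avoids _) (closing C)
    } , λ i → i , shadow-other (H-cycle-avoids-z₂ C i)
    where
    avoids : ∀ i → vtx C i ≢ z₁
    avoids i e = C∌z₁ (i , e)

  shadows-anticomplete : ∀ {u v a b} → a ≢ b × adj H a b ≡ false → shadow u ≡ a → shadow v ≡ b →
    u ≢ v × adj G u v ≡ false
  shadows-anticomplete (a≢b , ab) refl refl =
    (λ u≡v → a≢b (cong shadow u≡v)) , ¬-not (λ uv → true≢false (trans (sym (shadow-adj uv a≢b)) ab))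

  lift-anticomplete : ∀ C C′ → Anticomplete H C C′ →
    Anticomplete G (proj₁ (lift-cycle C)) (proj₁ (lift-cycle C′))
  lift-anticomplete C C′ anti i j =
    shadows-anticomplete (anti (proj₁ (D↦C i)) (proj₁ (D′↦C′ j))) (proj₂ (D↦C i)) (proj₂ (D′↦C′ j))
    where
    D↦C : Shadowed C (proj₁ (lift-cycle C))
    D↦C = proj₂ (lift-cycle C)
    D′↦C′ : Shadowed C′ (proj₁ (lift-cycle C′))
    D′↦C′ = proj₂ (lift-cycle C′)

  contract-plantation : ∀ {s Z} → Z z₁ ≡ true → Plantation s G Z → Plantation s H (Z ∖ z₂)
  contract-plantation {s} {Z} Zz₁ (sO-free , hitting) = sO-free′ , hitting′
    where
    sO-free′ : SOFree s H
    sO-free′ (Cs , anti) = sO-free (proj₁ ∘ lift-cycle ∘ Cs , λ a b a≢b →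
      lift-anticomplete (Cs a) (Cs b) (anti a b a≢b))
    hitting′ : CycleHitting H (Z ∖ z₂)
    hitting′ C with D , D↦C ← lift-cycle C with i , Zi ← hitting D =
      proj₁ (D↦C i) , subst (λ u → (Z ∖ z₂) u ≡ true) (proj₂ (D↦C i)) (shadow-∖ {Z} {vtx D i} Zz₁ Zi)

  module _ {l} {v : Fin (suc (suc l)) → Vertex G} (ip : InducedPath G (suc (suc l)) v)
           {j k} (vj≡z₂ : v j ≡ z₂) (vk≡z₁ : v k ≡ z₁) where

    path-adj⇒ℕ : ∀ {a b x y} → v a ≡ x → v b ≡ y → adj G x y ≡ true → Consecutiveℕ (toℕ a) (toℕ b)
    path-adj⇒ℕ {a} {b} refl refl xy = consecutive⇒ℕ a b (trans (sym (adj≡consecutive ip a b)) xy)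

    ℕ⇒path-adj : ∀ {a b x y} → v a ≡ x → v b ≡ y → Consecutiveℕ (toℕ a) (toℕ b) → adj G x y ≡ true
    ℕ⇒path-adj {a} {b} refl refl c = trans (adj≡consecutive ip a b) (ℕ⇒consecutive a b c)

    j~k : Consecutiveℕ (toℕ j) (toℕ k)
    j~k = path-adj⇒ℕ vj≡z₂ vk≡z₁ z₂z₁

    shortened : Fin (suc l) → Vertex G
    shortened a = v (punchIn j a)

    shortened≢z₂ : ∀ a → shortened a ≢ z₂
    shortened≢z₂ a e = Fin.punchInᵢ≢i j a (injective ip _ _ (trans e (sym vj≡z₂)))

    shortened-injective : ∀ a b → shortened a ≡ shortened b → a ≡ b
    shortened-injective a b e = Fin.punchIn-injective j a b (injective ip _ _ e)

    shortened-adj⇒consecutive : ∀ a b → adj H (shortened a) (shortened b) ≡ true →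
      Consecutiveℕ (toℕ a) (toℕ b)
    shortened-adj⇒consecutive a b h with contractAdj⁻ G z₁ z₂ (shortened a) (shortened b) h
    ... | _ , _ , _ , inj₁ xy =
      punchInℕ-consecutive⁻ (toℕ-punchIn j a) (toℕ-punchIn j b) (path-adj⇒ℕ refl refl xy)
    ... | _ , _ , x≢y , inj₂ (inj₁ (x≡z₁ , z₂y)) =
      punchInℕ-bridge (path-adj⇒ℕ vj≡z₂ x≡z₁ z₂z₁) (path-adj⇒ℕ vj≡z₂ refl z₂y)
                      (x≢y ∘ cong v ∘ Fin.toℕ-injective) (toℕ-punchIn j a) (toℕ-punchIn j b)
    ... | _ , _ , x≢y , inj₂ (inj₂ (y≡z₁ , xz₂)) =
      punchInℕ-bridge (swap (path-adj⇒ℕ refl vj≡z₂ xz₂)) (path-adj⇒ℕ vj≡z₂ y≡z₁ z₂z₁)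
                      (x≢y ∘ cong v ∘ Fin.toℕ-injective) (toℕ-punchIn j a) (toℕ-punchIn j b)

    -- Positions a, b that were separated by the deleted position j carry the two path-neighbours
    -- of z₂; one of them is z₁, so the other is adjacent to z₁ in the contraction.
    consecutive⇒shortened-adj : ∀ a b → a ≢ b → Consecutiveℕ (toℕ a) (toℕ b) →
      adj H (shortened a) (shortened b) ≡ true
    consecutive⇒shortened-adj a b a≢b a~b =
      contractAdj⁺ G z₁ z₂ (shortened a) (shortened b) (shortened≢z₂ a) (shortened≢z₂ b)
        (a≢b ∘ shortened-injective a b) (edge (Consecutiveℕ? (toℕ (punchIn j a)) (toℕ (punchIn j b))))
      where
      edge : Dec (Consecutiveℕ (toℕ (punchIn j a)) (toℕ (punchIn j b))) →
        ContractedEdge G z₁ z₂ (shortened a) (shortened b)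
      edge (yes a′~b′) = inj₁ (ℕ⇒path-adj refl refl a′~b′)
      edge (no ¬a′~b′)
        with j~a′ , j~b′ ← punchInℕ-gap (toℕ-punchIn j a) (toℕ-punchIn j b) a~b ¬a′~b′
        with Consecutiveℕ-two j~a′ j~b′ (a≢b ∘ Fin.punchIn-injective j a b ∘ Fin.toℕ-injective) j~k
      ... | inj₁ k≡a′ =
        inj₂ (inj₁ (trans (cong v (sym (Fin.toℕ-injective k≡a′))) vk≡z₁ ,
                    ℕ⇒path-adj vj≡z₂ refl j~b′))
      ... | inj₂ k≡b′ =
        inj₂ (inj₂ (trans (cong v (sym (Fin.toℕ-injective k≡b′))) vk≡z₁ ,
                    ℕ⇒path-adj refl vj≡z₂ (swap j~a′)))

    shortened-induced : InducedPath H (suc l) shortened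
    shortened-induced = record { injective = shortened-injective ; adj≡consecutive = agree }
      where
      agree : ∀ a b → adj H (shortened a) (shortened b) ≡ consecutive a b
      agree a b with a ≟ b
      ... | yes refl =
        trans (irrefl H (shortened a)) (sym (¬-not (Consecutiveℕ-irrefl ∘ consecutive⇒ℕ a a)))
      ... | no a≢b  = true⇔⇒≡ (ℕ⇒consecutive a b ∘ shortened-adj⇒consecutive a b)
                             (consecutive⇒shortened-adj a b a≢b ∘ consecutive⇒ℕ a b)

    shortened-end : ∀ {a e} → toℕ (punchIn j a) ≡ toℕ e ⊎ toℕ (punchIn j a) ≡ toℕ k →
      shortened a ≡ v e ⊎ shortened a ≡ z₁
    shortened-end = ⊎-map (cong v ∘ Fin.toℕ-injective)
                          (λ a′≡k → trans (cong v (Fin.toℕ-injective a′≡k)) vk≡z₁)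

    shortened-first : shortened zero ≡ v zero ⊎ shortened zero ≡ z₁
    shortened-first = shortened-end (punchInℕ-first (toℕ-punchIn j zero) (swap j~k))

    shortened-last : shortened (fromℕ l) ≡ v (fromℕ (suc l)) ⊎ shortened (fromℕ l) ≡ z₁
    shortened-last = shortened-end (⊎-map (λ a′≡sl → trans a′≡sl (sym (Fin.toℕ-fromℕ (suc l)))) id
      (punchInℕ-last (subst (λ t → PunchInℕ (toℕ j) t (toℕ (punchIn j (fromℕ l)))) (Fin.toℕ-fromℕ l)
                            (toℕ-punchIn j (fromℕ l)))
                     (≤-pred (Fin.toℕ<n j)) (≤-pred (Fin.toℕ<n k)) (swap j~k)))

  contract-covering : ∀ {Z S} → Z z₁ ≡ true → Z z₂ ≡ true →
    CoveringPath G Z S → CoveringPath H (Z ∖ z₂) (S ∖ z₂)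
  contract-covering Zz₁ Zz₂ (coveringPath Z⊆S zero _ v _ _ _ _ S⊆v)
    with zero , refl ← S⊆v z₁ (Z⊆S z₁ Zz₁)
    with zero , v₀≡z₂ ← S⊆v z₂ (Z⊆S z₂ Zz₂) = ⊥-elim (z₁≢z₂ v₀≡z₂)
  contract-covering {Z} {S} Zz₁ Zz₂ (coveringPath Z⊆S (suc l) l<n v ip v₀∈Z vₗ∈Z v∈S S⊆v)
    with j , vj≡z₂ ← S⊆v z₂ (Z⊆S z₂ Zz₂)
    with k , vk≡z₁ ← S⊆v z₁ (Z⊆S z₁ Zz₁) = record
    { Z⊆S        = λ u Z∖u → let Zu , u≢z₂ = ∖-true⁻ {S = Z} Z∖u in ∖-true⁺ {S = S} (Z⊆S u Zu) u≢z₂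
    ; len        = l
    ; len<order  = <-trans (n<1+n l) l<n
    ; vertex     = shortened ip vj≡z₂ vk≡z₁
    ; induced    = shortened-induced ip vj≡z₂ vk≡z₁
    ; first∈Z    = end∈Z (shortened-first ip vj≡z₂ vk≡z₁) v₀∈Z
    ; last∈Z     = end∈Z (shortened-last ip vj≡z₂ vk≡z₁) vₗ∈Z
    ; vertex∈S   = λ a → ∖-true⁺ {S = S} (v∈S _) (shortened≢z₂ ip vj≡z₂ vk≡z₁ a)
    ; S⊆vertices = covered
    }
    where
    end∈Z : ∀ {a y} → shortened ip vj≡z₂ vk≡z₁ a ≡ y ⊎ shortened ip vj≡z₂ vk≡z₁ a ≡ z₁ → Z y ≡ true →
      (Z ∖ z₂) (shortened ip vj≡z₂ vk≡z₁ a) ≡ true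
    end∈Z {a} (inj₁ refl) Zy = ∖-true⁺ {S = Z} Zy (shortened≢z₂ ip vj≡z₂ vk≡z₁ a)
    end∈Z {a} (inj₂ x≡z₁) _  =
      ∖-true⁺ {S = Z} (subst (λ u → Z u ≡ true) (sym x≡z₁) Zz₁) (shortened≢z₂ ip vj≡z₂ vk≡z₁ a)
    covered : ∀ u → (S ∖ z₂) u ≡ true → ∃ λ a → shortened ip vj≡z₂ vk≡z₁ a ≡ u
    covered u S∖u with Su , u≢z₂ ← ∖-true⁻ {S = S} S∖u with i , vi≡u ← S⊆v u Su =
      punchOut j≢i , trans (cong v (Fin.punchIn-punchOut j≢i)) vi≡u
      where
      j≢i : j ≢ i
      j≢i refl = u≢z₂ (trans (sym vi≡u) vj≡z₂)

  contract-nPaths : ∀ {Z} → Z z₁ ≡ true → Z z₂ ≡ true → nPaths G Z ≤ nPaths H (Z ∖ z₂)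
  contract-nPaths {Z} Zz₁ Zz₂ =
    countFun-≤-∖ (order G) z₂ (isZCoveringPathSet G Z) (isZCoveringPathSet H (Z ∖ z₂))
    (λ S h → Z⊆S (isZCoveringPathSet-sound G Z S h) z₂ Zz₂)
    (λ S h → isZCoveringPathSet-complete H (Z ∖ z₂) (S ∖ z₂)
               (contract-covering Zz₁ Zz₂ (isZCoveringPathSet-sound G Z S h)))
    (λ S S′ → isZCoveringPathSet-cong H (Z ∖ z₂))

  contract-size : ∀ {Z} → size H (Z ∖ z₂) ≤ size G Z
  contract-size {Z} = countFin-mono (order G) (λ u → proj₁ ∘ ∖-true⁻ {S = Z})

  contract-nonIsolated : nonIsolated H < nonIsolated G
  contract-nonIsolated = hasNeighbour-< (adj H) (adj G) neighbour z₂ z₁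
    (λ v h → H-adj-avoids-z₂ z₂ v h refl) z₂z₁
    where
    neighbour : ∀ u v → adj H u v ≡ true → ∃ λ w → adj G u w ≡ true
    neighbour u v h with contractAdj⁻ G z₁ z₂ u v h
    ... | _ , _ , _ , inj₁ uv                  = v , uv
    ... | _ , _ , _ , inj₂ (inj₁ (refl , _)) = z₂ , z₁z₂
    ... | _ , _ , _ , inj₂ (inj₂ (_ , uz₂))  = z₂ , uz₂

record Reduction (s : ℕ) (G : Graph) (Z : VSet G) : Set where
  constructor reduction
  field
    graph      : Graph
    terminals  : VSet graph
    plantation : Plantation s graph terminals
    dyadic     : Dyadic graph terminals
    order≤     : order graph ≤ order G
    size≤      : size graph terminals ≤ size G Z
    nPaths≤    : nPaths G Z ≤ nPaths graph terminals

Reduction-trans : ∀ {s G Z G₁} {Z₁ : VSet G₁} → order G₁ ≤ order G → size G₁ Z₁ ≤ size G Z →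
  nPaths G Z ≤ nPaths G₁ Z₁ → Reduction s G₁ Z₁ → Reduction s G Z
Reduction-trans o₁ s₁ n₁ (reduction G₂ Z₂ plantation dyadic o₂ s₂ n₂) =
  reduction G₂ Z₂ plantation dyadic (≤-trans o₂ o₁) (≤-trans s₂ s₁) (≤-trans n₁ n₂)

stable⊎edge : ∀ G (Z : VSet G) → Stable G Z ⊎ ∃ λ u → ∃ λ v → Z u ≡ true × Z v ≡ true × adj G u v ≡ true
stable⊎edge G Z with Fin.any? (λ u → Fin.any? (λ v →
                       (Z u Bool.≟ true) ×-dec (Z v Bool.≟ true) ×-dec (adj G u v Bool.≟ true)))
... | yes (u , v , edge) = inj₂ (u , v , edge)
... | no  ¬edge          = inj₁ λ u v Zu Zv → ¬-not (λ uv → ¬edge (u , v , Zu , Zv , uv))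

light⊎heavy : ∀ G (Z : VSet G) → (∀ v → zDegree G Z v ≤ 2) ⊎ ∃ λ x → 3 ≤ zDegree G Z x
light⊎heavy G Z with Fin.any? (λ x → 3 ℕ.≤? zDegree G Z x)
... | yes heavy = inj₂ heavy
... | no  ¬heavy = inj₁ λ v → ≤-pred (ℕ.≰⇒> (λ h → ¬heavy (v , h)))

_⊏_ : Graph → Graph → Set
_⊏_ = _<_ on nonIsolated

reduce : ∀ {s} G Z → Acc _⊏_ G → Plantation s G Z → Reduction s G Z
reduce {s} G Z (acc smaller) plantation with stable⊎edge G Z
... | inj₂ (z₁ , z₂ , Zz₁ , Zz₂ , z₁z₂) =
  Reduction-trans ≤-refl contract-size (contract-nPaths Zz₁ Zz₂)
    (reduce H (Z ∖ z₂) (smaller contract-nonIsolated) (contract-plantation Zz₁ plantation))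
  where open Contraction {G} {z₁} {z₂} z₁z₂
... | inj₁ stable with light⊎heavy G Z
... | inj₁ light = reduction G Z plantation (stable , λ v _ → light v) ≤-refl ≤-refl ≤-refl
... | inj₂ (x , heavy) with y , Zy∧xy ← countFin-witness (order G) _ (≤-trans (s≤s z≤n) heavy) =
  Reduction-trans ≤-refl ≤-refl (isolate-nPaths heavy)
    (reduce (isolate G x) Z (smaller (isolate-nonIsolated (∧-trueʳ {Z y} Zy∧xy)))
            (isolate-plantation {s} {Z} plantation))
  where open Isolation {G} {x}

mainTheorem16 : (s : ℕ) → 1 ≤ s → (G : Graph) → (Z : VSet G) → Plantation s G Z →
    Σ Graph λ G′ → Σ (VSet G′) λ Z′ →
      Plantation s G′ Z′ × Dyadic G′ Z′ ×
      order G′ ≤ order G × size G′ Z′ ≤ size G Z × nPaths G Z ≤ nPaths G′ Z′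
mainTheorem16 s _ G Z plantation
  with reduction G′ Z′ plantation′ dyadic o≤ s≤ n≤
         ← reduce G Z (On.wellFounded nonIsolated <-wellFounded G) plantation =
  G′ , Z′ , plantation′ , dyadic , o≤ , s≤ , n≤
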